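{- Let $U$ be a set with at least two elements and $\pi$ a partition on $U$. Let $\mathcal{B}(\pi)\subseteq\mathcal{P}(U)$ be the Boolean algebra of all unions of blocks of $\pi$ (the complete subalgebra of $\mathcal{P}(U)$ whose atoms are the blocks of $\pi$), and let $\mathcal{B}_\pi=\{\sigma\Rightarrow\pi:\sigma\in\Pi(U)\}$ ordered by refinement. Then, as Boolean algebras, $\mathcal{B}(\pi)\cong\mathcal{B}_\pi\times\prod_{\{u\}\in\pi}2$, where the product is over the singleton blocks of $\pi$ and $2$ is the two-element Boolean algebra.
   Context: A partition on $U$ is a set of nonempty pairwise disjoint blocks with union $U$; $\Pi(U)$ is the set of partitions on $U$; $\operatorname{dit}(\pi)$ is the set of ordered pairs in different blocks; refinement: $\sigma\preceq\tau$ iff $\operatorname{dit}(\sigma)\subseteq\operatorname{dit}(\tau)$. The implication $\sigma\Rightarrow\pi$ is the partition obtained from $\pi$ by replacing each block of $\pi$ that is contained in some block of $\sigma$ by singletons (equivalently $\operatorname{dit}(\sigma\Rightarrow\pi)=\operatorname{int}((U\times U\setminus\operatorname{dit}\sigma)\cup\operatorname{dit}\pi)$, where $\operatorname{int}(S)$ is the complement of the smallest equivalence relation containing the complement of $S$). $(\mathcal{B}_\pi,\preceq)$ is a Boolean algebra with bottom $\pi$ and top the discrete partition. -}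

module Defs where

open import Level using (Level; _⊔_; suc; 0ℓ)
open import Data.Bool using (Bool) renaming (_≤_ to _≤ᵇ_)
open import Data.Product using (Σ; ∃; ∃-syntax; _×_; _,_; proj₁; proj₂)
open import Data.Sum using (_⊎_; inj₁; inj₂)
open import Relation.Nullary using (¬_)
open import Relation.Binary.PropositionalEquality using (_≡_; refl; sym; trans; subst)
open import Relation.Binary.Structures using (IsEquivalence)
open import Function.Bundles using (_⇔_)

record Partition (U : Set) : Set₁ where
  field
    _~_ : U → U → Set
    isEquivalence : IsEquivalence _~_
  open IsEquivalence isEquivalence public

open Partition public using (_~_; isEquivalence)

module _ {U : Set} where

  dit : Partition U → U → U → Set
  dit π u v = ¬ (_~_ π u v)

  _≼_ : Partition U → Partition U → Set
  σ ≼ τ = ∀ u v → dit σ u v → dit τ u v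

  BlockContainedIn : Partition U → Partition U → U → Set
  BlockContainedIn σ π u = ∃[ v ] (∀ w → _~_ π u w → _~_ σ v w)

  private
    contained-move : (σ π : Partition U) {u u' : U} → _~_ π u u' →
                     BlockContainedIn σ π u' → BlockContainedIn σ π u
    contained-move σ π {u} {u'} p (v , h) =
      v , λ w q → h w (Partition.trans π (Partition.sym π p) q)

  -- σ ⇒ π : replace each block of π contained in some block of σ by
  -- singletons.  u, v are in the same block of σ ⇒ π iff u ≡ v, or they are
  -- in the same π-block and that block is not contained in a block of σ.
  _⇒_ : Partition U → Partition U → Partition U
  _~_ (σ ⇒ π) u v = (u ≡ v) ⊎ (_~_ π u v × ¬ BlockContainedIn σ π u)
  IsEquivalence.refl (isEquivalence (σ ⇒ π)) = inj₁ refl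
  IsEquivalence.sym (isEquivalence (σ ⇒ π)) (inj₁ e) = inj₁ (sym e)
  IsEquivalence.sym (isEquivalence (σ ⇒ π)) (inj₂ (p , n)) =
    inj₂ (Partition.sym π p , λ c → n (contained-move σ π p c))
  IsEquivalence.trans (isEquivalence (σ ⇒ π)) (inj₁ refl) q = q
  IsEquivalence.trans (isEquivalence (σ ⇒ π)) (inj₂ p) (inj₁ refl) = inj₂ p
  IsEquivalence.trans (isEquivalence (σ ⇒ π)) (inj₂ (p , n)) (inj₂ (q , _)) =
    inj₂ (Partition.trans π p q , n)

  -- ℬ(π): subsets of U that are unions of blocks of π.  An element is a
  -- subset S together with a set T of representatives such that S is the
  -- union of the blocks of the elements of T.
  record UnionOfBlocks (π : Partition U) : Set₁ where
    field
      carrier : U → Set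
      reps    : U → Set
      isUnion : ∀ x → carrier x ⇔ (∃[ u ] (reps u × _~_ π u x))

  open UnionOfBlocks public

  _⊆ᴮ_ : {π : Partition U} → UnionOfBlocks π → UnionOfBlocks π → Set
  S ⊆ᴮ S' = ∀ x → carrier S x → carrier S' x

  -- ℬ_π = { σ ⇒ π : σ ∈ Π(U) }: an element is presented by some σ, and
  -- ordered by refinement of the partitions σ ⇒ π.
  ImpElem : Partition U → Set₁
  ImpElem π = Partition U

  _≼ᵢ_ : {π : Partition U} → ImpElem π → ImpElem π → Set
  _≼ᵢ_ {π} σ σ' = (σ ⇒ π) ≼ (σ' ⇒ π)

  IsSingletonBlock : Partition U → U → Set
  IsSingletonBlock π u = ∀ v → _~_ π u v → u ≡ v

  -- ∏_{{u} ∈ π} 2, each element represented by a function U → Bool, of which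
  -- only the values at singleton blocks matter (componentwise order).
  SingletonProduct : Partition U → Set
  SingletonProduct π = U → Bool

  _≤ₚ_ : {π : Partition U} → SingletonProduct π → SingletonProduct π → Set
  _≤ₚ_ {π} g h = ∀ u → IsSingletonBlock π u → g u ≤ᵇ h u

  _≤×_ : {π : Partition U} → ImpElem π × SingletonProduct π →
         ImpElem π × SingletonProduct π → Set
  _≤×_ {π} (σ , g) (σ' , g') = _≼ᵢ_ {π} σ σ' × _≤ₚ_ {π} g g'

-- Order isomorphism (for Boolean algebras, i.e. complemented distributive
-- lattices, order isomorphisms are exactly the Boolean algebra isomorphisms):
-- an order-preserving and order-reflecting map that is surjective up to the
-- equivalence induced by the order.
OrderIso : {a b ℓ₁ ℓ₂ : Level} (A : Set a) (B : Set b) →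
           (A → A → Set ℓ₁) → (B → B → Set ℓ₂) → Set (a ⊔ b ⊔ ℓ₁ ⊔ ℓ₂)
OrderIso A B _≤A_ _≤B_ =
  Σ (A → B) λ f →
    (∀ x y → (x ≤A y) ⇔ (f x ≤B f y)) ×
    (∀ z → ∃[ x ] ((f x ≤B z) × (z ≤B f x)))

{-# OPTIONS --safe #-}

-- Replacing the π-blocks that lie inside σ-blocks by singletons leaves a
-- singleton block of π unchanged, so σ ⇒ π is determined by the set of
-- non-singleton blocks of π contained in a block of σ, and refinement of the
-- σ ⇒ π is inclusion of these sets.  Hence ℬ_π is the Boolean algebra of
-- unions of non-singleton blocks, while each singleton block contributes an
-- independent factor 2.  A union of blocks S corresponds to the pair
-- (σ_S, χ_S), where σ_S lumps S into one block and is discrete elsewhere.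
module Submission where

open import Defs
open import Axiom.ExcludedMiddle using (ExcludedMiddle)
open import Axiom.DoubleNegationElimination using (em⇒dne)
open import Level using (0ℓ)
open import Data.Bool using (Bool; true; false; T) renaming (_≤_ to _≤ᵇ_)
open import Data.Bool.Base using (b≤b)
open import Data.Bool.Properties using (≤-minimum)
open import Data.Empty using (⊥-elim)
open import Data.Product using (∃-syntax; _×_; _,_)
open import Data.Sum using (_⊎_; inj₁; inj₂)
open import Data.Unit using (tt)
open import Function.Bundles using (_⇔_; mk⇔; Equivalence)
open import Relation.Nullary using (¬_; yes; no; isYes)
open import Relation.Nullary.Decidable using (toWitness; fromWitness)
open import Relation.Binary.PropositionalEquality
  using (_≡_; _≢_; refl; subst) renaming (sym to ≡-sym; trans to ≡-trans)
open import Relation.Binary.Structures using (IsEquivalence)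

open Equivalence using (to; from)

≤ᵇ⇔T⇒T : ∀ {b c : Bool} → (b ≤ᵇ c) ⇔ (T b → T c)
≤ᵇ⇔T⇒T = mk⇔ ≤ᵇ⇒T⇒T T⇒T⇒≤ᵇ
  where
    ≤ᵇ⇒T⇒T : ∀ {b c} → b ≤ᵇ c → T b → T c
    ≤ᵇ⇒T⇒T b≤b t = t
    T⇒T⇒≤ᵇ : ∀ {b c} → (T b → T c) → b ≤ᵇ c
    T⇒T⇒≤ᵇ {false} {c}     _ = ≤-minimum c
    T⇒T⇒≤ᵇ {true}  {true}  _ = b≤b
    T⇒T⇒≤ᵇ {true}  {false} h = ⊥-elim (h tt)

lump : {U : Set} → (U → Set) → Partition U
_~_ (lump S) u v = (u ≡ v) ⊎ (S u × S v)
IsEquivalence.refl  (isEquivalence (lump S)) = inj₁ refl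
IsEquivalence.sym   (isEquivalence (lump S)) (inj₁ e)       = inj₁ (≡-sym e)
IsEquivalence.sym   (isEquivalence (lump S)) (inj₂ (a , b)) = inj₂ (b , a)
IsEquivalence.trans (isEquivalence (lump S)) (inj₁ refl)    q        = q
IsEquivalence.trans (isEquivalence (lump S)) (inj₂ p)       (inj₁ refl) = inj₂ p
IsEquivalence.trans (isEquivalence (lump S)) (inj₂ (a , _)) (inj₂ (_ , c)) =
  inj₂ (a , c)

module _ {U : Set} (π : Partition U) where

  private
    _≈_ : U → U → Set
    _≈_ = _~_ π

  Closed : (U → Set) → Set
  Closed S = ∀ {x y} → S x → x ≈ y → S y

  carrier-closed : (S : UnionOfBlocks π) → Closed (carrier S)
  carrier-closed S {x} {y} sx x≈y with to (isUnion S x) sx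
  ... | u , ru , u≈x = from (isUnion S y) (u , ru , Partition.trans π u≈x x≈y)

  unionOfBlocks : {S : U → Set} → Closed S → UnionOfBlocks π
  unionOfBlocks {S} closed = record
    { carrier = S
    ; reps    = S
    ; isUnion = λ x → mk⇔ (λ sx → x , sx , Partition.refl π)
                          (λ { (u , su , u≈x) → closed su u≈x })
    }

  isSingletonBlock-resp : ∀ {x y} → x ≈ y →
                          IsSingletonBlock π y → IsSingletonBlock π x
  isSingletonBlock-resp {x} x≈y sy v x≈v =
    ≡-trans (≡-sym (sy x (Partition.sym π x≈y)))
            (sy v (Partition.trans π (Partition.sym π x≈y) x≈v))

  blockContainedIn-resp : (σ : Partition U) {x y : U} → x ≈ y →
                          BlockContainedIn σ π y → BlockContainedIn σ π x
  blockContainedIn-resp σ x≈y (v , h) =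
    v , λ w x≈w → h w (Partition.trans π (Partition.sym π x≈y) x≈w)

  ⇒-≼-fromContained : (σ τ : Partition U) →
    (∀ u → ¬ IsSingletonBlock π u →
       BlockContainedIn σ π u → BlockContainedIn τ π u) →
    (σ ⇒ π) ≼ (τ ⇒ π)
  ⇒-≼-fromContained σ τ h u v σ-dit (inj₁ u≡v) = σ-dit (inj₁ u≡v)
  ⇒-≼-fromContained σ τ h u v σ-dit (inj₂ (u≈v , ¬τ)) =
    σ-dit (inj₂ (u≈v , λ cσ → ¬τ (h u nonSingleton cσ)))
    where
      nonSingleton : ¬ IsSingletonBlock π u
      nonSingleton s = σ-dit (inj₁ (s v u≈v))

  -- Two distinct points of one π-block stay together in σ ⇒ π exactly when
  -- their block is not contained in a σ-block.
  ⇒-≼-toContained : (σ τ : Partition U) {u y : U} → u ≈ y → u ≢ y →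
    (σ ⇒ π) ≼ (τ ⇒ π) →
    BlockContainedIn σ π u → ¬ ¬ BlockContainedIn τ π u
  ⇒-≼-toContained σ τ {u} {y} u≈y u≢y h cσ ¬cτ =
    h u y σ-dit (inj₂ (u≈y , ¬cτ))
    where
      σ-dit : dit (σ ⇒ π) u y
      σ-dit (inj₁ u≡y)       = u≢y u≡y
      σ-dit (inj₂ (_ , ¬cσ)) = ¬cσ cσ

  closed⇒blockContainedIn-lump : {S : U → Set} → Closed S →
    ∀ {u} → S u → BlockContainedIn (lump S) π u
  closed⇒blockContainedIn-lump closed {u} su =
    u , λ w u≈w → inj₂ (su , closed su u≈w)

  blockContainedIn-lump⇒ : {S : U → Set} {u y : U} → u ≈ y → u ≢ y →
    BlockContainedIn (lump S) π u → S u
  blockContainedIn-lump⇒ {S} {u} {y} u≈y u≢y (v , h) =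
    member (h u (Partition.refl π)) (h y u≈y)
    where
      member : _~_ (lump S) v u → _~_ (lump S) v y → S u
      member (inj₂ (_ , su)) _ = su
      member (inj₁ v≡u) (inj₁ v≡y) = ⊥-elim (u≢y (≡-trans (≡-sym v≡u) v≡y))
      member (inj₁ v≡u) (inj₂ (sv , _)) = subst S v≡u sv

module Classical (em : ExcludedMiddle 0ℓ) {U : Set} (π : Partition U) where

  private
    _≈_ : U → U → Set
    _≈_ = _~_ π

    Singleton : U → Set
    Singleton = IsSingletonBlock π

    Contained : Partition U → U → Set
    Contained σ = BlockContainedIn σ π

    dne : {A : Set} → ¬ ¬ A → A
    dne = em⇒dne em

  nonSingleton⇒mate : ∀ {u} → ¬ Singleton u → ∃[ y ] (u ≈ y × u ≢ y)
  nonSingleton⇒mate ns =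
    dne λ ¬mate → ns λ v u≈v → dne λ u≢v → ¬mate (v , u≈v , u≢v)

  ⇒-≼⇔contained : (σ τ : Partition U) →
    ((σ ⇒ π) ≼ (τ ⇒ π)) ⇔
    (∀ u → ¬ Singleton u → Contained σ u → Contained τ u)
  ⇒-≼⇔contained σ τ = mk⇔ reflect (⇒-≼-fromContained π σ τ)
    where
      reflect : (σ ⇒ π) ≼ (τ ⇒ π) →
                ∀ u → ¬ Singleton u → Contained σ u → Contained τ u
      reflect h u ns cσ with nonSingleton⇒mate ns
      ... | y , u≈y , u≢y = dne (⇒-≼-toContained π σ τ u≈y u≢y h cσ)

  blockContainedIn-lump⇔ : {S : U → Set} → Closed π S →
    ∀ {u} → ¬ Singleton u → Contained (lump S) u ⇔ S u
  blockContainedIn-lump⇔ closed ns with nonSingleton⇒mate ns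
  ... | y , u≈y , u≢y =
    mk⇔ (blockContainedIn-lump⇒ π u≈y u≢y) (closed⇒blockContainedIn-lump π closed)

  Decode : ImpElem π × SingletonProduct π → U → Set
  Decode (σ , g) u = (¬ Singleton u × Contained σ u) ⊎ (Singleton u × T (g u))

  decode-closed : (z : ImpElem π × SingletonProduct π) → Closed π (Decode z)
  decode-closed (σ , g) (inj₁ (ns , c)) x≈y =
    inj₁ ((λ sy → ns (isSingletonBlock-resp π x≈y sy)) ,
          blockContainedIn-resp π σ (Partition.sym π x≈y) c)
  decode-closed (σ , g) (inj₂ (s , t)) x≈y =
    subst (Decode (σ , g)) (s _ x≈y) (inj₂ (s , t))

  ≤×⇔decode-⊆ : (z z' : ImpElem π × SingletonProduct π) →
    (_≤×_ {π = π} z z') ⇔ (∀ u → Decode z u → Decode z' u)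
  ≤×⇔decode-⊆ (σ , g) (σ' , g') = mk⇔ ≤×⇒⊆ ⊆⇒≤×
    where
      ≤×⇒⊆ : _≤×_ {π = π} (σ , g) (σ' , g') →
             ∀ u → Decode (σ , g) u → Decode (σ' , g') u
      ≤×⇒⊆ (h , _) u (inj₁ (ns , c)) =
        inj₁ (ns , to (⇒-≼⇔contained σ σ') h u ns c)
      ≤×⇒⊆ (_ , hp) u (inj₂ (s , t)) = inj₂ (s , to ≤ᵇ⇔T⇒T (hp u s) t)

      ⊆⇒≤× : (∀ u → Decode (σ , g) u → Decode (σ' , g') u) →
             _≤×_ {π = π} (σ , g) (σ' , g')
      ⊆⇒≤× k =
        from (⇒-≼⇔contained σ σ') contained , λ u s → from ≤ᵇ⇔T⇒T (bit u s)
        where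
          contained : ∀ u → ¬ Singleton u → Contained σ u → Contained σ' u
          contained u ns c with k u (inj₁ (ns , c))
          ... | inj₁ (_ , c') = c'
          ... | inj₂ (s , _)  = ⊥-elim (ns s)
          bit : ∀ u → Singleton u → T (g u) → T (g' u)
          bit u s t with k u (inj₂ (s , t))
          ... | inj₁ (ns , _) = ⊥-elim (ns s)
          ... | inj₂ (_ , t') = t'

  encode : UnionOfBlocks π → ImpElem π × SingletonProduct π
  encode S = lump (carrier S) , λ u → isYes (em {carrier S u})

  decode-encode : (S : UnionOfBlocks π) → ∀ u → Decode (encode S) u ⇔ carrier S u
  decode-encode S u = mk⇔ decoded encoded
    where
      decoded : Decode (encode S) u → carrier S u
      decoded (inj₁ (ns , c)) = to (blockContainedIn-lump⇔ (carrier-closed π S) ns) c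
      decoded (inj₂ (_ , t))  = toWitness {a? = em} t
      encoded : carrier S u → Decode (encode S) u
      encoded su with em {Singleton u}
      ... | yes s  = inj₂ (s , fromWitness {a? = em} su)
      ... | no ns  =
        inj₁ (ns , closed⇒blockContainedIn-lump π (carrier-closed π S) su)

  encode-⊆⇔≤× : (S S' : UnionOfBlocks π) →
    (_⊆ᴮ_ {π = π} S S') ⇔ (_≤×_ {π = π} (encode S) (encode S'))
  encode-⊆⇔≤× S S' = mk⇔
    (λ S⊆S' → from ≤×⇔ λ u d →
        from (decode-encode S' u) (S⊆S' u (to (decode-encode S u) d)))
    (λ S≤S' u su → to (decode-encode S' u)
        (to ≤×⇔ S≤S' u (from (decode-encode S u) su)))
    where
      ≤×⇔ : (_≤×_ {π = π} (encode S) (encode S')) ⇔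
            (∀ u → Decode (encode S) u → Decode (encode S') u)
      ≤×⇔ = ≤×⇔decode-⊆ (encode S) (encode S')

  encode-decode : (z : ImpElem π × SingletonProduct π) →
    let S = unionOfBlocks π (decode-closed z) in
    (_≤×_ {π = π} (encode S) z) × (_≤×_ {π = π} z (encode S))
  encode-decode z =
    from (≤×⇔decode-⊆ (encode S) z) (λ u → to (decode-encode S u)) ,
    from (≤×⇔decode-⊆ z (encode S)) (λ u → from (decode-encode S u))
    where
      S = unionOfBlocks π (decode-closed z)

mainTheorem13 : ExcludedMiddle 0ℓ →
    (U : Set) → (∃[ a ] ∃[ b ] ¬ (_≡_ {A = U} a b)) → (π : Partition U) →
    OrderIso (UnionOfBlocks π) (ImpElem π × SingletonProduct π)
    (_⊆ᴮ_ {U} {π}) (_≤×_ {U} {π})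
mainTheorem13 em U _ π =
  encode , encode-⊆⇔≤× , λ z → unionOfBlocks π (decode-closed z) , encode-decode z
  where open Classical em π
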